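{- Let $T$ be a tree with at least one edge and let $\ell\ge 1$. Then $\chi_s'(T\Box C_{4\ell})=2\Delta(T)+4$, where $C_{4\ell}$ is the cycle of length $4\ell$.
   Context: $\Delta(T)$ is the maximum degree of $T$. The Cartesian product $G\Box H$ has vertex set $V(G)\times V(H)$, with $(a,u)\sim(b,v)$ iff either $a=b$ and $uv\in E(H)$, or $u=v$ and $ab\in E(G)$. A strong edge coloring is a proper edge coloring in which every color class is an induced matching; $\chi_s'(G)$ is the minimum number of colors in such a coloring. -}

module Defs where

open import Data.Nat using (ℕ; zero; suc; _≤_; _⊔_; _∸_; _≡ᵇ_)
open import Data.Bool using (Bool; true; false; T; _∨_; _∧_)
open import Data.Fin using (Fin; toℕ)
open import Data.List using (List; []; _∷_; _++_; [_]; length; filterᵇ; map; foldr; allFin)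
open import Data.List.Relation.Unary.Linked using (Linked)
open import Data.List.Relation.Unary.Unique.Propositional using (Unique)
open import Data.Product using (_×_; _,_; Σ; ∃; ∃-syntax)
open import Data.Sum using (_⊎_)
open import Relation.Binary.PropositionalEquality using (_≡_)
open import Relation.Nullary using (¬_)

record Graph (n : ℕ) : Set where
  field
    adj    : Fin n → Fin n → Bool
    sym    : ∀ u v → adj u v ≡ adj v u
    irrefl : ∀ v → adj v v ≡ false
open Graph public

E : ∀ {n} → Graph n → Fin n → Fin n → Set
E G u v = T (adj G u v)

data Walk {n} (G : Graph n) : Fin n → Fin n → Set where
  here : ∀ {u} → Walk G u u
  step : ∀ {u w v} → E G u w → Walk G w v → Walk G u v

Connected : ∀ {n} → Graph n → Set
Connected {n} G = (u v : Fin n) → Walk G u v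

IsCycle : ∀ {n} → Graph n → Fin n → List (Fin n) → Set
IsCycle G v vs = (2 ≤ length vs) × Unique (v ∷ vs) × Linked (E G) ((v ∷ vs) ++ [ v ])

Acyclic : ∀ {n} → Graph n → Set
Acyclic {n} G = (v : Fin n) (vs : List (Fin n)) → ¬ IsCycle G v vs

IsTree : ∀ {n} → Graph n → Set
IsTree G = Connected G × Acyclic G

degree : ∀ {n} → Graph n → Fin n → ℕ
degree {n} G v = length (filterᵇ (adj G v) (allFin n))

Δ : ∀ {n} → Graph n → ℕ
Δ {n} G = foldr _⊔_ 0 (map (degree G) (allFin n))

-- the cycle C_m on vertex set Fin m = {0,…,m-1}: i ~ j iff j ≡ i+1 (mod m) or i ≡ j+1 (mod m)
succMod : (m : ℕ) → Fin m → Fin m → Bool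
succMod m i j = (toℕ j ≡ᵇ suc (toℕ i)) ∨ ((toℕ i ≡ᵇ m ∸ 1) ∧ (toℕ j ≡ᵇ 0))

CycleAdj : (m : ℕ) → Fin m → Fin m → Set
CycleAdj m i j = T (succMod m i j ∨ succMod m j i)

BoxAdj : ∀ {n} → Graph n → (m : ℕ) → (Fin n × Fin m) → (Fin n × Fin m) → Set
BoxAdj G m (a , u) (b , v) = (a ≡ b × CycleAdj m u v) ⊎ (u ≡ v × E G a b)

-- A strong edge coloring with k colors of the graph with vertex type V and edge relation R:
-- each edge gets a colour (independent of orientation), and any two edges uv, xy of the
-- same colour with u = x or ux an edge must be the same edge (so every colour class is an
-- induced matching; in particular the colouring is proper).
record StrongEdgeColoring {V : Set} (R : V → V → Set) (k : ℕ) : Set where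
  field
    col    : (u v : V) → R u v → Fin k
    col-sym : (u v : V) (p : R u v) (q : R v u) → col u v p ≡ col v u q
    strong : (u v x y : V) (p : R u v) (q : R x y) → col u v p ≡ col x y q →
             (u ≡ x ⊎ R u x) → (u ≡ x × v ≡ y) ⊎ (u ≡ y × v ≡ x)

StrongChromaticIndexIs : {V : Set} → (V → V → Set) → ℕ → Set
StrongChromaticIndexIs R c = StrongEdgeColoring R c × ((k : ℕ) → StrongEdgeColoring R k → c ≤ k)

{-# OPTIONS --safe #-}
-- Root T at a vertex r and name each tree edge by its lower end c, i.e. the edge c — parent c.
-- Labels label c < Δ form a proper edge colouring of T. Two edges of equal label at distance one
-- are related by `Above`, which is functional and decreases depth, so the parity of the length of
-- the `Above`-chain from c separates them. In T □ C_m the copy in layer u of the edge of c gets the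
-- colour (label c , parity of u ⊕ chain parity of c), and the cycle edge between layers i and i + 1
-- at a tree vertex of depth d gets one of four further colours, i + 2d mod 4; both parities and
-- residues mod 4 are consistent around the cycle because 4 ∣ m. Conversely, for a vertex a of
-- maximum degree with a neighbour b, the 2Δ + 3 edges at (a , 0) or (a , 1) together with
-- (b , 0)(b , 1) pairwise share a vertex or are joined by an edge, so they need 2Δ + 4 colours.
module Submission where

open import Defs hiding (sym)
open import Data.Nat using (ℕ; zero; suc; _+_; _*_; _≤_; _<_; z≤n; s≤s; _⊔_; _<ᵇ_; _≡ᵇ_; pred) renaming (_≟_ to _≟ℕ_)
open import Data.Nat.Properties hiding (_≟_)
open import Data.Nat.Solver using (module +-*-Solver)
open import Data.Bool using (Bool; true; false; T; _∨_; _∧_; not; _xor_; if_then_else_)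
open import Data.Bool.Properties using (T?; T-≡; T-∨; T-∧; ∨-comm; not-¬; not-injective; xor-comm)
open import Data.Fin using (Fin; zero; suc; toℕ; fromℕ; fromℕ<; _↑ˡ_; _↑ʳ_; splitAt; join; combine; punchOut)
open import Data.Fin.Properties
  using (_≟_; any?; toℕ-injective; toℕ<n; toℕ-fromℕ; fromℕ<-injective; combine-injective; punchOut-injective;
         splitAt-join; splitAt-↑ˡ; splitAt-↑ʳ; splitAt⁻¹-↑ˡ; splitAt⁻¹-↑ʳ)
import Data.Fin.Properties as Fin
open import Data.List using (List; []; _∷_; _++_; [_]; length; filterᵇ; map; foldr; tabulate)
open import Data.List.Properties using (++-assoc; length-++)
open import Data.List.Relation.Unary.All as All using (All; []; _∷_)
import Data.List.Relation.Unary.All.Properties as All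
open import Data.List.Relation.Unary.AllPairs using ([]; _∷_)
import Data.List.Relation.Unary.AllPairs.Properties as AllPairs
open import Data.List.Relation.Unary.Linked using (Linked; [-]; _∷_)
open import Data.List.Relation.Unary.Unique.Propositional using (Unique)
open import Data.Product using (∃; ∃-syntax; _×_; _,_; proj₁; proj₂)
open import Data.Sum using (_⊎_; inj₁; inj₂; [_,_]′)
import Data.Sum as Sum
open import Data.Sum.Properties using (inj₁-injective; inj₂-injective)
open import Data.Empty using (⊥; ⊥-elim)
open import Function using (_∘_; id; const)
open import Function.Bundles using (Equivalence)
open import Function.Definitions using (Injective)
open import Relation.Binary.PropositionalEquality hiding ([_])
open import Relation.Binary.Definitions using (tri<; tri≈; tri>)
open import Relation.Nullary using (¬_; yes; no; Dec; _×-dec_; _⊎-dec_; ¬?)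
open import Relation.Nullary.Decidable using (isYes; fromWitness; toWitness)

open ≡-Reasoning
open +-*-Solver using (solve; _:+_; _:*_; _:=_; con)

-- Counting over Fin n

true⇒T : ∀ {b} → b ≡ true → T b
true⇒T = Equivalence.from T-≡

count : ∀ {n} → (Fin n → Bool) → ℕ
count {zero}  p = 0
count {suc n} p = (if p zero then 1 else 0) + count (p ∘ suc)

count-mono : ∀ {n} {p q : Fin n → Bool} → (∀ i → T (p i) → T (q i)) → count p ≤ count q
count-mono {zero} p⇒q = z≤n
count-mono {suc n} {p} {q} p⇒q with p zero in p₀ | q zero in q₀
... | false | false = count-mono (p⇒q ∘ suc)
... | false | true  = m≤n⇒m≤1+n (count-mono (p⇒q ∘ suc))
... | true  | true  = s≤s (count-mono (p⇒q ∘ suc))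
... | true  | false = ⊥-elim (subst T q₀ (p⇒q zero (true⇒T p₀)))

count-< : ∀ {n} {p q : Fin n → Bool} → (∀ i → T (p i) → T (q i)) →
          (j : Fin n) → p j ≡ false → q j ≡ true → count p < count q
count-< {suc n} {p} {q} p⇒q zero pj qj rewrite pj | qj = s≤s (count-mono (p⇒q ∘ suc))
count-< {suc n} {p} {q} p⇒q (suc j) pj qj with p zero in p₀ | q zero in q₀
... | false | false = count-< (p⇒q ∘ suc) j pj qj
... | false | true  = m≤n⇒m≤1+n (count-< (p⇒q ∘ suc) j pj qj)
... | true  | true  = s≤s (count-< (p⇒q ∘ suc) j pj qj)
... | true  | false = ⊥-elim (subst T q₀ (p⇒q zero (true⇒T p₀)))

count-pos : ∀ {n} (p : Fin n → Bool) (i : Fin n) → T (p i) → 0 < count p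
count-pos p zero pi with p zero
... | true = s≤s z≤n
count-pos p (suc i) pi with p zero
... | true  = s≤s z≤n
... | false = count-pos (p ∘ suc) i pi

count-witness : ∀ {n} (p : Fin n → Bool) → 0 < count p → ∃ λ i → T (p i)
count-witness {suc n} p pos with p zero in p₀
... | true  = zero , true⇒T p₀
... | false with count-witness (p ∘ suc) pos
...   | i , pi = suc i , pi

count-cong : ∀ {n} {p q : Fin n → Bool} → (∀ i → p i ≡ q i) → count p ≡ count q
count-cong {zero}  p≗q = refl
count-cong {suc n} p≗q = cong₂ (λ b c → (if b then 1 else 0) + c) (p≗q zero) (count-cong (p≗q ∘ suc))

count-+ : ∀ m n (p : Fin (m + n) → Bool) →
          count p ≡ count (λ i → p (i ↑ˡ n)) + count (λ i → p (m ↑ʳ i))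
count-+ zero    n p = refl
count-+ (suc m) n p =
  trans (cong ((if p zero then 1 else 0) +_) (count-+ m n (p ∘ suc))) (sym (+-assoc (if p zero then 1 else 0) _ _))

count-splitAt : ∀ m n (p : Fin m ⊎ Fin n → Bool) → count (p ∘ splitAt m) ≡ count (p ∘ inj₁) + count (p ∘ inj₂)
count-splitAt m n p = trans (count-+ m n (p ∘ splitAt m))
  (cong₂ _+_ (count-cong (λ i → cong p (splitAt-↑ˡ m i n))) (count-cong (λ i → cong p (splitAt-↑ʳ m n i))))

[,]∘splitAt-injective : ∀ {A : Set} m n {f : Fin m → A} {g : Fin n → A} →
                        Injective _≡_ _≡_ f → Injective _≡_ _≡_ g → (∀ i j → f i ≢ g j) →
                        Injective _≡_ _≡_ ([ f , g ]′ ∘ splitAt m)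
[,]∘splitAt-injective m n f-inj g-inj f≢g {i} {j} e with splitAt m i in eᵢ | splitAt m j in eⱼ
... | inj₁ x | inj₁ y = trans (sym (splitAt⁻¹-↑ˡ eᵢ)) (trans (cong (_↑ˡ n) (f-inj e)) (splitAt⁻¹-↑ˡ eⱼ))
... | inj₂ x | inj₂ y = trans (sym (splitAt⁻¹-↑ʳ eᵢ)) (trans (cong (m ↑ʳ_) (g-inj e)) (splitAt⁻¹-↑ʳ eⱼ))
... | inj₁ x | inj₂ y = ⊥-elim (f≢g x y e)
... | inj₂ x | inj₁ y = ⊥-elim (f≢g y x (sym e))

count-≤-injective : ∀ {n k} (p : Fin n → Bool) (g : ∀ i → T (p i) → Fin k) →
                    (∀ {i j} (pi : T (p i)) (pj : T (p j)) → g i pi ≡ g j pj → i ≡ j) →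
                    count p ≤ k
count-≤-injective {zero} p g g-inj = z≤n
count-≤-injective {suc n} p g g-inj with p zero in p₀
... | false = count-≤-injective (p ∘ suc) (g ∘ suc) (λ pi pj → Fin.suc-injective ∘ g-inj pi pj)
count-≤-injective {suc n} {zero} p g g-inj | true with g zero (true⇒T p₀)
... | ()
count-≤-injective {suc n} {suc k} p g g-inj | true =
  s≤s (count-≤-injective (p ∘ suc) g′
         (λ pi pj → Fin.suc-injective ∘ g-inj pi pj ∘ punchOut-injective {i = g zero (true⇒T p₀)} _ _))
  where
  g′ : ∀ i → T (p (suc i)) → Fin k
  g′ i pi = punchOut (Fin.0≢1+n ∘ g-inj (true⇒T p₀) pi)

length-filter-tabulate : ∀ {n} {A : Set} (p : A → Bool) (f : Fin n → A) →
                         length (filterᵇ p (tabulate f)) ≡ count (p ∘ f)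
length-filter-tabulate {zero}  p f = refl
length-filter-tabulate {suc n} p f with p (f zero)
... | true  = cong suc (length-filter-tabulate p (f ∘ suc))
... | false = length-filter-tabulate p (f ∘ suc)

≤-foldr-⊔ : ∀ {n} {A : Set} (f : A → ℕ) (h : Fin n → A) (i : Fin n) →
            f (h i) ≤ foldr _⊔_ 0 (map f (tabulate h))
≤-foldr-⊔ f h zero    = m≤m⊔n _ _
≤-foldr-⊔ f h (suc i) = ≤-trans (≤-foldr-⊔ f (h ∘ suc) i) (m≤n⊔m _ _)

foldr-⊔-attained : ∀ {n} {A : Set} (f : A → ℕ) (h : Fin n → A) →
                   let M = foldr _⊔_ 0 (map f (tabulate h)) in M ≡ 0 ⊎ ∃ λ i → f (h i) ≡ M
foldr-⊔-attained {zero}  f h = inj₁ refl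
foldr-⊔-attained {suc n} f h with ⊔-sel (f (h zero)) (foldr _⊔_ 0 (map f (tabulate (h ∘ suc))))
... | inj₁ M≡f₀ = inj₂ (zero , sym M≡f₀)
... | inj₂ M≡rest with foldr-⊔-attained f (h ∘ suc)
...   | inj₁ rest≡0        = inj₁ (trans M≡rest rest≡0)
...   | inj₂ (i , fi≡rest) = inj₂ (suc i , trans fi≡rest (sym M≡rest))

degree≡count : ∀ {n} (G : Graph n) (v : Fin n) → degree G v ≡ count (adj G v)
degree≡count G v = length-filter-tabulate (adj G v) id

degree≤Δ : ∀ {n} (G : Graph n) (v : Fin n) → count (adj G v) ≤ Δ G
degree≤Δ G v = subst (_≤ Δ G) (degree≡count G v) (≤-foldr-⊔ (degree G) id v)

-- Rooted trees

least : (ℕ → Bool) → ℕ → ℕ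
least P zero    = 0
least P (suc b) = if P 0 then 0 else suc (least (P ∘ suc) b)

least-satisfies : ∀ (P : ℕ → Bool) b → T (P b) → T (P (least P b))
least-satisfies P zero    Pb = Pb
least-satisfies P (suc b) Pb with P 0 in P₀
... | true  = true⇒T P₀
... | false = least-satisfies (P ∘ suc) b Pb

least-minimal : ∀ (P : ℕ → Bool) b k → T (P k) → least P b ≤ k
least-minimal P zero    k       Pk = z≤n
least-minimal P (suc b) k       Pk with P 0 in P₀
least-minimal P (suc b) k       Pk | true  = z≤n
least-minimal P (suc b) zero    Pk | false = ⊥-elim (subst T P₀ Pk)
least-minimal P (suc b) (suc k) Pk | false = s≤s (least-minimal (P ∘ suc) b k Pk)

Unique-∷ʳ : ∀ {A : Set} {xs : List A} {y} → Unique xs → All (y ≢_) xs → Unique (xs ++ [ y ])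
Unique-∷ʳ xs! y∉xs = AllPairs.++⁺ xs! ([] ∷ []) (All.map (λ y≢x → (λ x≡y → y≢x (sym x≡y)) ∷ []) y∉xs)

module _ {n} (G : Graph n) where

  E-sym : ∀ {u v} → E G u v → E G v u
  E-sym {u} {v} = subst T (Graph.sym G u v)

  E-irrefl : ∀ {u} → ¬ E G u u
  E-irrefl {u} = subst T (Graph.irrefl G u)

  E⇒≢ : ∀ {u v} → E G u v → u ≢ v
  E⇒≢ uv refl = E-irrefl uv

module RootedTree {n} (G : Graph n) (connected : Connected G) (acyclic : Acyclic G) (r : Fin n) where

  within : ℕ → Fin n → Bool
  within zero    v = isYes (v ≟ r)
  within (suc k) v = within k v ∨ isYes (any? (T? ∘ adj-within k v))
    where adj-within : ℕ → Fin n → Fin n → Bool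
          adj-within k v w = adj G v w ∧ within k w

  within-zero : ∀ {v} → T (within 0 v) → v ≡ r
  within-zero = toWitness

  root-within-zero : T (within 0 r)
  root-within-zero = fromWitness refl

  within-step : ∀ k {v w} → E G v w → T (within k w) → T (within (suc k) v)
  within-step k {v} {w} vw wk =
    Equivalence.from (T-∨ {within k v}) (inj₂ (fromWitness (_ , Equivalence.from (T-∧ {adj G v w}) (vw , wk))))

  within-inv : ∀ k {v} → T (within (suc k) v) → T (within k v) ⊎ ∃ λ w → E G v w × T (within k w)
  within-inv k {v} vk with Equivalence.to (T-∨ {within k v}) vk
  ... | inj₁ vk′ = inj₁ vk′
  ... | inj₂ w?  with toWitness w?
  ...   | w , vwk = inj₂ (w , Equivalence.to (T-∧ {adj G v w}) vwk)

  walk-within : ∀ {v} → Walk G v r → ∃ λ k → T (within k v)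
  walk-within here          = 0 , root-within-zero
  walk-within (step vw wr) with walk-within wr
  ... | k , wk = suc k , within-step k vw wk

  depthBound : Fin n → ℕ
  depthBound v = proj₁ (walk-within (connected v r))

  depth : Fin n → ℕ
  depth v = least (λ k → within k v) (depthBound v)

  within-depth : ∀ v → T (within (depth v) v)
  within-depth v = least-satisfies (λ k → within k v) (depthBound v) (proj₂ (walk-within (connected v r)))

  depth-minimal : ∀ v k → T (within k v) → depth v ≤ k
  depth-minimal v = least-minimal (λ k → within k v) (depthBound v)

  depth-root : depth r ≡ 0
  depth-root = n≤0⇒n≡0 (depth-minimal r 0 root-within-zero)

  depth≡0⇒root : ∀ {v} → depth v ≡ 0 → v ≡ r
  depth≡0⇒root {v} d≡0 = within-zero (subst (λ k → T (within k v)) d≡0 (within-depth v))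

  depth-edge : ∀ {v w} → E G v w → depth v ≤ suc (depth w)
  depth-edge {v} {w} vw = depth-minimal v _ (within-step (depth w) vw (within-depth w))

  depth-suc⇒≢root : ∀ {v k} → depth v ≡ suc k → v ≢ r
  depth-suc⇒≢root d≡1+k refl = 0≢1+n (trans (sym depth-root) d≡1+k)

  IsParent : Fin n → Fin n → Set
  IsParent v w = E G v w × suc (depth w) ≡ depth v

  ≢root⇒depth-suc : ∀ {v} → v ≢ r → ∃ λ k → depth v ≡ suc k
  ≢root⇒depth-suc {v} v≢r with depth v in d≡
  ... | zero  = ⊥-elim (v≢r (depth≡0⇒root d≡))
  ... | suc k = k , refl

  lower-neighbour : ∀ {v} → v ≢ r → ∃ (IsParent v)
  lower-neighbour {v} v≢r with ≢root⇒depth-suc v≢r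
  ... | k , d≡ with within-inv k (subst (λ j → T (within j v)) d≡ (within-depth v))
  ...   | inj₁ vk = ⊥-elim (1+n≰n (subst (_≤ k) d≡ (depth-minimal v k vk)))
  ...   | inj₂ (w , vw , wk) = w , vw , sym (trans d≡ (cong suc (≤-antisym k≤dw (depth-minimal w k wk))))
    where
    k≤dw : k ≤ depth w
    k≤dw = ≤-pred (subst (_≤ suc (depth w)) d≡ (depth-edge vw))

  IsParent? : ∀ v w → Dec (IsParent v w)
  IsParent? v w = T? (adj G v w) ×-dec (suc (depth w) ≟ℕ depth v)

  parent : Fin n → Fin n
  parent v with any? (IsParent? v)
  ... | yes (w , _) = w
  ... | no _        = r

  parent-isParent : ∀ {v} → v ≢ r → IsParent v (parent v)
  parent-isParent {v} v≢r with any? (IsParent? v)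
  ... | yes (_ , vw) = vw
  ... | no ¬parent   = ⊥-elim (¬parent (lower-neighbour v≢r))

  parent-adjacent : ∀ {v} → v ≢ r → E G v (parent v)
  parent-adjacent = proj₁ ∘ parent-isParent

  depth-parent : ∀ {v} → v ≢ r → suc (depth (parent v)) ≡ depth v
  depth-parent = proj₂ ∘ parent-isParent

  depth-parent-pred : ∀ {v k} → depth v ≡ suc k → depth (parent v) ≡ k
  depth-parent-pred d≡ = suc-injective (trans (depth-parent (depth-suc⇒≢root d≡)) d≡)

  parent-asym : ∀ {v w} → v ≢ r → w ≢ r → parent v ≡ w → parent w ≢ v
  parent-asym {v} {w} v≢r w≢r refl wv = <-asym (≤-reflexive (depth-parent v≢r))
    (subst (λ u → suc (depth u) ≤ depth (parent v)) wv (≤-reflexive (depth-parent w≢r)))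

  -- For x and y of depth k: up from x to their lowest common ancestor, then down to y.
  ancestorPath : ℕ → Fin n → Fin n → List (Fin n)
  ancestorPath zero    x y = [ x ]
  ancestorPath (suc k) x y with x ≟ y
  ... | yes _ = [ x ]
  ... | no  _ = x ∷ (ancestorPath k (parent x) (parent y) ++ [ y ])

  ancestorPath-linked : ∀ k {x y a b rest} → depth x ≡ k → depth y ≡ k →
                        E G a x → E G y b → Linked (E G) (b ∷ rest) →
                        Linked (E G) (a ∷ ancestorPath k x y ++ b ∷ rest)
  ancestorPath-linked zero {x} {y} dx dy ax yb brest
    with refl ← trans (depth≡0⇒root dx) (sym (depth≡0⇒root dy)) = ax ∷ yb ∷ brest
  ancestorPath-linked (suc k) {x} {y} {b = b} {rest} dx dy ax yb brest with x ≟ y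
  ... | yes refl = ax ∷ yb ∷ brest
  ... | no  _    = ax ∷ subst (Linked (E G)) (cong (x ∷_) (sym (++-assoc (ancestorPath k (parent x) (parent y)) [ y ] (b ∷ rest))))
                     (ancestorPath-linked k (depth-parent-pred dx) (depth-parent-pred dy)
                       (parent-adjacent (depth-suc⇒≢root dx)) (E-sym G (parent-adjacent (depth-suc⇒≢root dy))) (yb ∷ brest))

  ancestorPath-depth : ∀ k {x y} → depth x ≡ k → depth y ≡ k → All (λ z → depth z ≤ k) (ancestorPath k x y)
  ancestorPath-depth zero    dx dy = ≤-reflexive dx ∷ []
  ancestorPath-depth (suc k) {x} {y} dx dy with x ≟ y
  ... | yes _ = ≤-reflexive dx ∷ []
  ... | no  _ = ≤-reflexive dx ∷ All.++⁺ (All.map m≤n⇒m≤1+n below) (≤-reflexive dy ∷ [])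
    where below = ancestorPath-depth k (depth-parent-pred dx) (depth-parent-pred dy)

  deeper-∉ : ∀ {k xs} y → k < depth y → All (λ z → depth z ≤ k) xs → All (y ≢_) xs
  deeper-∉ y k<dy = All.map λ dz≤k y≡z → <⇒≱ k<dy (subst (λ t → depth t ≤ _) (sym y≡z) dz≤k)

  ancestorPath-unique : ∀ k {x y} → depth x ≡ k → depth y ≡ k → Unique (ancestorPath k x y)
  ancestorPath-unique zero    dx dy = [] ∷ []
  ancestorPath-unique (suc k) {x} {y} dx dy with x ≟ y
  ... | yes _ = [] ∷ []
  ... | no x≢y = All.++⁺ (deeper-∉ x (≤-reflexive (sym dx)) below) (x≢y ∷ [])
               ∷ Unique-∷ʳ (ancestorPath-unique k dpx dpy) (deeper-∉ y (≤-reflexive (sym dy)) below)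
    where
    dpx = depth-parent-pred dx
    dpy = depth-parent-pred dy
    below = ancestorPath-depth k dpx dpy

  ancestorPath-nonempty : ∀ k {x y} → 1 ≤ length (ancestorPath k x y)
  ancestorPath-nonempty zero = s≤s z≤n
  ancestorPath-nonempty (suc k) {x} {y} with x ≟ y
  ... | yes _ = s≤s z≤n
  ... | no  _ = s≤s z≤n

  ancestorPath-length : ∀ k {x y} → depth x ≡ k → depth y ≡ k → x ≢ y → 2 ≤ length (ancestorPath k x y)
  ancestorPath-length zero    dx dy x≢y = ⊥-elim (x≢y (trans (depth≡0⇒root dx) (sym (depth≡0⇒root dy))))
  ancestorPath-length (suc k) {x} {y} dx dy x≢y with x ≟ y
  ... | yes x≡y = ⊥-elim (x≢y x≡y)
  ... | no  _   = s≤s (subst (1 ≤_) (sym (length-++ (ancestorPath k (parent x) (parent y))))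
                         (≤-trans (ancestorPath-nonempty k) (m≤m+n _ 1)))

  lower-neighbour-unique : ∀ {u w₁ w₂ k} → E G u w₁ → E G u w₂ → depth w₁ ≡ k → depth w₂ ≡ k →
                           depth u ≡ suc k → w₁ ≡ w₂
  lower-neighbour-unique {u} {w₁} {w₂} {k} uw₁ uw₂ d₁ d₂ du with w₁ ≟ w₂
  ... | yes w₁≡w₂ = w₁≡w₂
  ... | no  w₁≢w₂ = ⊥-elim (acyclic u (ancestorPath k w₁ w₂)
        ( ancestorPath-length k d₁ d₂ w₁≢w₂
        , deeper-∉ u (≤-reflexive (sym du)) (ancestorPath-depth k d₁ d₂) ∷ ancestorPath-unique k d₁ d₂
        , ancestorPath-linked k d₁ d₂ uw₁ (E-sym G uw₂) [-]))

  edge-depth≢ : ∀ {u w} → E G u w → depth u ≢ depth w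
  edge-depth≢ {u} {w} uw du≡dw with depth u in du
  ... | zero  = E⇒≢ G uw (trans (depth≡0⇒root du) (sym (depth≡0⇒root (sym du≡dw))))
  ... | suc k = acyclic u (path ++ [ w ]) (length-ok , unique , linked)
    where
    dw : depth w ≡ suc k
    dw = sym du≡dw
    dpu = depth-parent-pred du
    dpw = depth-parent-pred dw
    path = ancestorPath k (parent u) (parent w)
    below = ancestorPath-depth k dpu dpw
    length-ok : 2 ≤ length (path ++ [ w ])
    length-ok = subst (2 ≤_) (sym (length-++ path)) (+-monoˡ-≤ 1 (ancestorPath-nonempty k))
    unique : Unique (u ∷ path ++ [ w ])
    unique = All.++⁺ (deeper-∉ u (≤-reflexive (sym du)) below) (E⇒≢ G uw ∷ [])
           ∷ Unique-∷ʳ (ancestorPath-unique k dpu dpw) (deeper-∉ w (≤-reflexive (sym dw)) below)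
    linked : Linked (E G) ((u ∷ path ++ [ w ]) ++ [ u ])
    linked = subst (Linked (E G)) (cong (u ∷_) (sym (++-assoc path [ w ] [ u ])))
               (ancestorPath-linked k dpu dpw (parent-adjacent (depth-suc⇒≢root du))
                 (E-sym G (parent-adjacent (depth-suc⇒≢root dw))) (E-sym G uw ∷ [-]))

  deeper-end-parent : ∀ {u w} → E G u w → depth w < depth u → u ≢ r × parent u ≡ w
  deeper-end-parent {u} {w} uw dw<du =
    u≢r , sym (lower-neighbour-unique uw (parent-adjacent u≢r) refl (depth-parent-pred du) du)
    where
    du : depth u ≡ suc (depth w)
    du = ≤-antisym (depth-edge uw) dw<du
    u≢r = depth-suc⇒≢root du

  edge-parent : ∀ {u w} → E G u w → (u ≢ r × parent u ≡ w) ⊎ (w ≢ r × parent w ≡ u)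
  edge-parent {u} {w} uw with <-cmp (depth u) (depth w)
  ... | tri< du<dw _ _ = inj₂ (deeper-end-parent (E-sym G uw) du<dw)
  ... | tri≈ _ du≡dw _ = ⊥-elim (edge-depth≢ uw du≡dw)
  ... | tri> _ _ dw<du = inj₁ (deeper-end-parent uw dw<du)

  edge-depth : ∀ {u w} → E G u w → depth u ≡ suc (depth w) ⊎ depth w ≡ suc (depth u)
  edge-depth uw with edge-parent uw
  ... | inj₁ (u≢r , refl) = inj₁ (sym (depth-parent u≢r))
  ... | inj₂ (w≢r , refl) = inj₂ (sym (depth-parent w≢r))

-- A proper edge labelling of a tree

module EdgeLabelling {n} (G : Graph n) (connected : Connected G) (acyclic : Acyclic G) (r : Fin n)
                     (D : ℕ) (degree≤D : ∀ x → count (adj G x) ≤ D) where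

  open RootedTree G connected acyclic r public

  rank : Fin n → Fin n → ℕ
  rank x y = count (λ z → adj G x z ∧ (toℕ z <ᵇ toℕ y))

  private
    T-∧-intro : ∀ {a b} → T a → T b → T (a ∧ b)
    T-∧-intro a b = Equivalence.from T-∧ (a , b)

    not-before-self : ∀ x y → (adj G x y ∧ (toℕ y <ᵇ toℕ y)) ≡ false
    not-before-self x y with adj G x y
    ... | false = refl
    ... | true  = <ᵇ-irrefl (toℕ y)
      where <ᵇ-irrefl : ∀ m → (m <ᵇ m) ≡ false
            <ᵇ-irrefl zero    = refl
            <ᵇ-irrefl (suc m) = <ᵇ-irrefl m

  rank-<-D : ∀ {x y} → E G x y → rank x y < D
  rank-<-D {x} {y} xy = ≤-trans
    (count-< (λ _ → proj₁ ∘ Equivalence.to T-∧) y (not-before-self x y) (Equivalence.to T-≡ xy))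
    (degree≤D x)

  rank-mono : ∀ {x y₁ y₂} → E G x y₁ → toℕ y₁ < toℕ y₂ → rank x y₁ < rank x y₂
  rank-mono {x} {y₁} {y₂} xy₁ y₁<y₂ = count-<
    (λ z z<y₁ → let (xz , z<y₁) = Equivalence.to T-∧ z<y₁ in
                T-∧-intro xz (<⇒<ᵇ (<-trans (<ᵇ⇒< _ _ z<y₁) y₁<y₂)))
    y₁ (not-before-self x y₁) (Equivalence.to T-≡ (T-∧-intro xy₁ (<⇒<ᵇ y₁<y₂)))

  rank-injective : ∀ {x y₁ y₂} → E G x y₁ → E G x y₂ → rank x y₁ ≡ rank x y₂ → y₁ ≡ y₂
  rank-injective {x} {y₁} {y₂} xy₁ xy₂ eq with <-cmp (toℕ y₁) (toℕ y₂)
  ... | tri< y₁<y₂ _ _ = ⊥-elim (<-irrefl eq (rank-mono xy₁ y₁<y₂))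
  ... | tri≈ _ y₁≡y₂ _ = toℕ-injective y₁≡y₂
  ... | tri> _ _ y₂<y₁ = ⊥-elim (<-irrefl (sym eq) (rank-mono xy₂ y₂<y₁))

  -- A child takes its rank among the neighbours of its parent x, unless that is the label of x;
  -- it then takes the rank of the parent of x, which no other child of x can take.
  relabel : Fin n → ℕ → ℕ
  relabel v parentLabel with parent v ≟ r
  ... | yes _ = rank (parent v) v
  ... | no  _ with rank (parent v) v ≟ℕ parentLabel
  ...   | yes _ = rank (parent v) (parent (parent v))
  ...   | no  _ = rank (parent v) v

  labelUpTo : ℕ → Fin n → ℕ
  labelUpTo zero    v = 0
  labelUpTo (suc k) v = relabel v (labelUpTo k (parent v))

  label : Fin n → ℕ
  label v = labelUpTo (depth v) v

  LabelCases : Fin n → Fin n → Set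
  LabelCases v x = (x ≡ r × label v ≡ rank x v)
                 ⊎ (x ≢ r × rank x v ≡ label x × label v ≡ rank x (parent x))
                 ⊎ (x ≢ r × rank x v ≢ label x × label v ≡ rank x v)

  label-cases : ∀ {v x} → v ≢ r → parent v ≡ x → LabelCases v x
  label-cases {v} v≢r refl
    rewrite sym (cong (λ k → labelUpTo k v) (depth-parent v≢r)) with parent v ≟ r
  ... | yes x≡r = inj₁ (x≡r , refl)
  ... | no  x≢r with rank (parent v) v ≟ℕ label (parent v)
  ...   | yes clash = inj₂ (inj₁ (x≢r , clash , refl))
  ...   | no  fresh = inj₂ (inj₂ (x≢r , fresh , refl))

  parent-to-child : ∀ {v x} → v ≢ r → parent v ≡ x → E G x v
  parent-to-child v≢r refl = E-sym G (parent-adjacent v≢r)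

  label-<-D : ∀ {v} → v ≢ r → label v < D
  label-<-D {v} v≢r with label-cases {v} v≢r refl
  ... | inj₁ (_ , lv)                = subst (_< D) (sym lv) (rank-<-D (parent-to-child v≢r refl))
  ... | inj₂ (inj₁ (x≢r , _ , lv))   = subst (_< D) (sym lv) (rank-<-D (parent-adjacent x≢r))
  ... | inj₂ (inj₂ (_ , _ , lv))     = subst (_< D) (sym lv) (rank-<-D (parent-to-child v≢r refl))

  label-child≢parent : ∀ {v x} → v ≢ r → parent v ≡ x → x ≢ r → label v ≢ label x
  label-child≢parent {v} v≢r vx x≢r lv≡lx with label-cases v≢r vx
  ... | inj₁ (x≡r , _)            = x≢r x≡r
  ... | inj₂ (inj₁ (_ , clash , lv)) = parent-asym x≢r v≢r
        (rank-injective (parent-adjacent x≢r) (parent-to-child v≢r vx) (trans (sym lv) (trans lv≡lx (sym clash)))) vx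
  ... | inj₂ (inj₂ (_ , fresh , lv)) = fresh (trans (sym lv) lv≡lx)

  label-siblings-injective : ∀ {a b x} → a ≢ r → b ≢ r → parent a ≡ x → parent b ≡ x →
                             label a ≡ label b → a ≡ b
  label-siblings-injective {a} {b} a≢r b≢r ax bx la≡lb with label-cases a≢r ax | label-cases b≢r bx
  ... | inj₁ (_ , la)             | inj₁ (_ , lb)             =
        rank-injective (parent-to-child a≢r ax) (parent-to-child b≢r bx) (trans (sym la) (trans la≡lb lb))
  ... | inj₁ (x≡r , _)            | inj₂ (inj₁ (x≢r , _))     = ⊥-elim (x≢r x≡r)
  ... | inj₁ (x≡r , _)            | inj₂ (inj₂ (x≢r , _))     = ⊥-elim (x≢r x≡r)
  ... | inj₂ (inj₁ (x≢r , _))     | inj₁ (x≡r , _)            = ⊥-elim (x≢r x≡r)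
  ... | inj₂ (inj₂ (x≢r , _))     | inj₁ (x≡r , _)            = ⊥-elim (x≢r x≡r)
  ... | inj₂ (inj₁ (_ , ca , _))  | inj₂ (inj₁ (_ , cb , _))  =
        rank-injective (parent-to-child a≢r ax) (parent-to-child b≢r bx) (trans ca (sym cb))
  ... | inj₂ (inj₂ (_ , _ , la))  | inj₂ (inj₂ (_ , _ , lb))  =
        rank-injective (parent-to-child a≢r ax) (parent-to-child b≢r bx) (trans (sym la) (trans la≡lb lb))
  ... | inj₂ (inj₁ (x≢r , _ , la)) | inj₂ (inj₂ (_ , _ , lb)) =
        ⊥-elim (parent-asym x≢r b≢r (rank-injective (parent-adjacent x≢r) (parent-to-child b≢r bx)
                                       (trans (sym la) (trans la≡lb lb))) bx)
  ... | inj₂ (inj₂ (_ , _ , la)) | inj₂ (inj₁ (x≢r , _ , lb)) =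
        ⊥-elim (parent-asym x≢r a≢r (rank-injective (parent-adjacent x≢r) (parent-to-child a≢r ax)
                                       (trans (sym lb) (trans (sym la≡lb) la))) ax)

  -- The edge of w has the label of the edge of v and meets the edge of parent v.
  Above : Fin n → Fin n → Set
  Above v w = v ≢ r × parent v ≢ r × w ≢ r × label w ≡ label v
            × (w ≡ parent (parent v) ⊎ (parent w ≡ parent (parent v) × w ≢ parent v))

  Above? : ∀ v w → Dec (Above v w)
  Above? v w = ¬? (v ≟ r) ×-dec ¬? (parent v ≟ r) ×-dec ¬? (w ≟ r) ×-dec (label w ≟ℕ label v)
             ×-dec ((w ≟ parent (parent v)) ⊎-dec ((parent w ≟ parent (parent v)) ×-dec ¬? (w ≟ parent v)))

  Above-depth : ∀ {v w} → Above v w → depth w < depth v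
  Above-depth {v} {w} (v≢r , pv≢r , _ , _ , inj₁ refl) =
    <-trans (≤-reflexive (depth-parent pv≢r)) (≤-reflexive (depth-parent v≢r))
  Above-depth {v} {w} (v≢r , pv≢r , w≢r , _ , inj₂ (pw≡ppv , _)) =
    subst (_< depth v) (trans (sym (depth-parent pv≢r)) (trans (cong (suc ∘ depth) (sym pw≡ppv)) (depth-parent w≢r)))
          (≤-reflexive (depth-parent v≢r))

  Above-functional : ∀ {v w₁ w₂} → Above v w₁ → Above v w₂ → w₁ ≡ w₂
  Above-functional (_ , _ , _ , _ , inj₁ e₁) (_ , _ , _ , _ , inj₁ e₂) = trans e₁ (sym e₂)
  Above-functional (_ , _ , w₁≢r , l₁ , inj₂ (e₁ , _)) (_ , _ , w₂≢r , l₂ , inj₂ (e₂ , _)) =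
    label-siblings-injective w₁≢r w₂≢r e₁ e₂ (trans l₁ (sym l₂))
  Above-functional (_ , _ , w₁≢r , l₁ , inj₁ e₁) (_ , _ , w₂≢r , l₂ , inj₂ (e₂ , _)) =
    ⊥-elim (label-child≢parent w₂≢r e₂ (λ z → w₁≢r (trans e₁ z)) (trans l₂ (trans (sym l₁) (cong label e₁))))
  Above-functional (_ , _ , w₁≢r , l₁ , inj₂ (e₁ , _)) (_ , _ , w₂≢r , l₂ , inj₁ e₂) =
    ⊥-elim (label-child≢parent w₁≢r e₁ (λ z → w₂≢r (trans e₂ z)) (trans l₁ (trans (sym l₂) (cong label e₂))))

  -- The Above-chain from v is unique and decreases depth, so depth v steps exhaust it.
  chainLengthUpTo : ℕ → Fin n → ℕ
  chainLengthUpTo zero    v = 0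
  chainLengthUpTo (suc k) v with any? (Above? v)
  ... | yes (w , _) = suc (chainLengthUpTo k w)
  ... | no  _       = 0

  chainLength : Fin n → ℕ
  chainLength v = chainLengthUpTo (depth v) v

  chainLengthUpTo-stable : ∀ k k′ v → depth v ≤ k → depth v ≤ k′ → chainLengthUpTo k v ≡ chainLengthUpTo k′ v
  chainLengthUpTo-stable zero zero v _ _ = refl
  chainLengthUpTo-stable zero (suc k′) v d≤0 _ with any? (Above? v)
  ... | yes (_ , v≢r , _) = ⊥-elim (v≢r (depth≡0⇒root (n≤0⇒n≡0 d≤0)))
  ... | no  _             = refl
  chainLengthUpTo-stable (suc k) zero v _ d≤0 with any? (Above? v)
  ... | yes (_ , v≢r , _) = ⊥-elim (v≢r (depth≡0⇒root (n≤0⇒n≡0 d≤0)))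
  ... | no  _             = refl
  chainLengthUpTo-stable (suc k) (suc k′) v d≤k d≤k′ with any? (Above? v)
  ... | yes (w , vw) = cong suc (chainLengthUpTo-stable k k′ w (≤-pred (≤-trans (Above-depth vw) d≤k))
                                                            (≤-pred (≤-trans (Above-depth vw) d≤k′)))
  ... | no  _        = refl

  chainLength-Above : ∀ {v w} → Above v w → chainLength v ≡ suc (chainLength w)
  chainLength-Above {v} {w} vw@(v≢r , _) =
    trans (cong (λ k → chainLengthUpTo k v) (sym (depth-parent v≢r))) (unfold (depth-parent v≢r))
    where
    unfold : ∀ {k} → suc k ≡ depth v → chainLengthUpTo (suc k) v ≡ suc (chainLength w)
    unfold {k} dv with any? (Above? v)
    ... | no  ¬above    = ⊥-elim (¬above (w , vw))
    ... | yes (w′ , vw′) with Above-functional vw vw′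
    ...   | refl = cong suc (chainLengthUpTo-stable k (depth w) w
                     (≤-pred (subst (depth w <_) (sym dv) (Above-depth vw))) ≤-refl)

  EndOf : Fin n → Fin n → Set
  EndOf c x = x ≡ c ⊎ x ≡ parent c

  private
    Above-via : ∀ {c₁ c₂ a} → c₁ ≢ r → c₂ ≢ r → c₁ ≢ c₂ → label c₁ ≡ label c₂ →
                EndOf c₁ a → a ≢ r → EndOf c₂ (parent a) → Above c₁ c₂
    Above-via c₁≢r c₂≢r c₁≢c₂ l (inj₁ refl) a≢r (inj₁ e) = ⊥-elim (label-child≢parent c₁≢r e c₂≢r l)
    Above-via c₁≢r c₂≢r c₁≢c₂ l (inj₁ refl) a≢r (inj₂ e) =
      ⊥-elim (c₁≢c₂ (label-siblings-injective c₁≢r c₂≢r e refl l))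
    Above-via c₁≢r c₂≢r c₁≢c₂ l (inj₂ refl) a≢r (inj₁ e) = c₁≢r , a≢r , c₂≢r , sym l , inj₁ (sym e)
    Above-via c₁≢r c₂≢r c₁≢c₂ l (inj₂ refl) a≢r (inj₂ e) =
      c₁≢r , a≢r , c₂≢r , sym l , inj₂ (sym e , λ c₂≡a → label-child≢parent c₁≢r (sym c₂≡a) c₂≢r l)

  sameLabel-joined⇒Above : ∀ {c₁ c₂ x₁ x₂} → c₁ ≢ r → c₂ ≢ r → c₁ ≢ c₂ → label c₁ ≡ label c₂ →
                           EndOf c₁ x₁ → EndOf c₂ x₂ → E G x₁ x₂ → Above c₁ c₂ ⊎ Above c₂ c₁
  sameLabel-joined⇒Above c₁≢r c₂≢r c₁≢c₂ l x₁∈ x₂∈ x₁x₂ with edge-parent x₁x₂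
  ... | inj₁ (x₁≢r , e) = inj₁ (Above-via c₁≢r c₂≢r c₁≢c₂ l x₁∈ x₁≢r (Sum.map (trans e) (trans e) x₂∈))
  ... | inj₂ (x₂≢r , e) =
        inj₂ (Above-via c₂≢r c₁≢r (c₁≢c₂ ∘ sym) (sym l) x₂∈ x₂≢r (Sum.map (trans e) (trans e) x₁∈))

  ChildOf : Fin n → Fin n → Fin n → Set
  ChildOf c x y = c ≢ r × ((x ≡ c × y ≡ parent c) ⊎ (y ≡ c × x ≡ parent c))

  childEnd : Fin n → Fin n → Fin n
  childEnd x y with x ≟ r
  ... | yes _ = y
  ... | no  _ with parent x ≟ y
  ...   | yes _ = x
  ...   | no  _ = y

  childEnd-spec : ∀ {x y} → E G x y → ChildOf (childEnd x y) x y
  childEnd-spec {x} {y} xy with edge-parent xy | x ≟ r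
  ... | inj₁ (x≢r , _) | yes x≡r = ⊥-elim (x≢r x≡r)
  ... | inj₂ (y≢r , e) | yes _   = y≢r , inj₂ (refl , sym e)
  ... | inj₁ (x≢r , e) | no _ with parent x ≟ y
  ...   | yes _ = x≢r , inj₁ (refl , sym e)
  ...   | no ne = ⊥-elim (ne e)
  childEnd-spec {x} {y} xy | inj₂ (y≢r , e) | no x≢r with parent x ≟ y
  ...   | yes e′ = ⊥-elim (parent-asym x≢r y≢r e′ e)
  ...   | no  _  = y≢r , inj₂ (refl , sym e)

  ChildOf-endOf : ∀ {c x y} → ChildOf c x y → EndOf c x
  ChildOf-endOf (_ , inj₁ (e , _)) = inj₁ e
  ChildOf-endOf (_ , inj₂ (_ , e)) = inj₂ e

  ChildOf-swap : ∀ {c x y} → ChildOf c x y → ChildOf c y x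
  ChildOf-swap (c≢r , inj₁ e) = c≢r , inj₂ e
  ChildOf-swap (c≢r , inj₂ e) = c≢r , inj₁ e

  ChildOf-functional : ∀ {c c′ x y} → ChildOf c x y → ChildOf c′ x y → c ≡ c′
  ChildOf-functional (_ , inj₁ (refl , _))    (_ , inj₁ (refl , _))   = refl
  ChildOf-functional (_ , inj₂ (refl , _))    (_ , inj₂ (refl , _))   = refl
  ChildOf-functional (c≢r , inj₁ (refl , refl)) (c′≢r , inj₂ (refl , e)) = ⊥-elim (parent-asym c≢r c′≢r refl (sym e))
  ChildOf-functional (c≢r , inj₂ (refl , refl)) (c′≢r , inj₁ (refl , e)) = ⊥-elim (parent-asym c≢r c′≢r refl (sym e))

  childEnd-sym : ∀ {x y} → E G x y → childEnd x y ≡ childEnd y x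
  childEnd-sym xy = ChildOf-functional (childEnd-spec xy) (ChildOf-swap (childEnd-spec (E-sym G xy)))

  ChildOf-same : ∀ {c x₁ y₁ x₂ y₂} → ChildOf c x₁ y₁ → ChildOf c x₂ y₂ → x₁ ≢ x₂ → x₂ ≡ y₁ × y₂ ≡ x₁
  ChildOf-same (_ , inj₁ (refl , refl)) (_ , inj₁ (refl , refl)) x₁≢x₂ = ⊥-elim (x₁≢x₂ refl)
  ChildOf-same (_ , inj₁ (refl , refl)) (_ , inj₂ (refl , refl)) _     = refl , refl
  ChildOf-same (_ , inj₂ (refl , refl)) (_ , inj₁ (refl , refl)) _     = refl , refl
  ChildOf-same (_ , inj₂ (refl , refl)) (_ , inj₂ (refl , refl)) x₁≢x₂ = ⊥-elim (x₁≢x₂ refl)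

  childEnd-label-injective : ∀ {x y₁ y₂} → E G x y₁ → E G x y₂ →
                             label (childEnd x y₁) ≡ label (childEnd x y₂) → y₁ ≡ y₂
  childEnd-label-injective {x} {y₁} {y₂} xy₁ xy₂ = go (childEnd-spec xy₁) (childEnd-spec xy₂)
    where
    go : ∀ {c₁ c₂} → ChildOf c₁ x y₁ → ChildOf c₂ x y₂ → label c₁ ≡ label c₂ → y₁ ≡ y₂
    go (_ , inj₁ (refl , e₁))  (_ , inj₁ (refl , e₂))  l = trans e₁ (sym e₂)
    go (c₁≢r , inj₁ (refl , e₁)) (c₂≢r , inj₂ (refl , e₂)) l =
      ⊥-elim (label-child≢parent c₂≢r (sym e₂) c₁≢r (sym l))
    go (c₁≢r , inj₂ (refl , e₁)) (c₂≢r , inj₁ (refl , e₂)) l =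
      ⊥-elim (label-child≢parent c₁≢r (sym e₁) c₂≢r l)
    go (c₁≢r , inj₂ (refl , e₁)) (c₂≢r , inj₂ (refl , e₂)) l =
      label-siblings-injective c₁≢r c₂≢r (sym e₁) (sym e₂) l

-- Residues mod 4 along the cycle

data ℤ₄ : Set where
  0₄ 1₄ 2₄ 3₄ : ℤ₄

suc₄ : ℤ₄ → ℤ₄
suc₄ 0₄ = 1₄
suc₄ 1₄ = 2₄
suc₄ 2₄ = 3₄
suc₄ 3₄ = 0₄

pred₄ : ℤ₄ → ℤ₄
pred₄ 0₄ = 3₄
pred₄ 1₄ = 0₄
pred₄ 2₄ = 1₄
pred₄ 3₄ = 2₄

pred₄-suc₄ : ∀ z → pred₄ (suc₄ z) ≡ z
pred₄-suc₄ 0₄ = refl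
pred₄-suc₄ 1₄ = refl
pred₄-suc₄ 2₄ = refl
pred₄-suc₄ 3₄ = refl

suc₄-injective : ∀ {a b} → suc₄ a ≡ suc₄ b → a ≡ b
suc₄-injective {a} {b} e = trans (sym (pred₄-suc₄ a)) (trans (cong pred₄ e) (pred₄-suc₄ b))

suc₄z≢z : ∀ z → suc₄ z ≢ z
suc₄z≢z 0₄ ()
suc₄z≢z 1₄ ()
suc₄z≢z 2₄ ()
suc₄z≢z 3₄ ()

suc₄²z≢z : ∀ z → suc₄ (suc₄ z) ≢ z
suc₄²z≢z 0₄ ()
suc₄²z≢z 1₄ ()
suc₄²z≢z 2₄ ()
suc₄²z≢z 3₄ ()

suc₄³z≢z : ∀ z → suc₄ (suc₄ (suc₄ z)) ≢ z
suc₄³z≢z 0₄ ()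
suc₄³z≢z 1₄ ()
suc₄³z≢z 2₄ ()
suc₄³z≢z 3₄ ()

odd₄ : ℤ₄ → Bool
odd₄ 0₄ = false
odd₄ 1₄ = true
odd₄ 2₄ = false
odd₄ 3₄ = true

odd₄-suc₄ : ∀ z → odd₄ (suc₄ z) ≡ not (odd₄ z)
odd₄-suc₄ 0₄ = refl
odd₄-suc₄ 1₄ = refl
odd₄-suc₄ 2₄ = refl
odd₄-suc₄ 3₄ = refl

toFin₄ : ℤ₄ → Fin 4
toFin₄ 0₄ = zero
toFin₄ 1₄ = suc zero
toFin₄ 2₄ = suc (suc zero)
toFin₄ 3₄ = suc (suc (suc zero))

toFin₄-injective : ∀ {a b} → toFin₄ a ≡ toFin₄ b → a ≡ b
toFin₄-injective {a} {b} e = trans (sym (from-to a)) (trans (cong fromFin₄ e) (from-to b))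
  where
  fromFin₄ : Fin 4 → ℤ₄
  fromFin₄ zero                   = 0₄
  fromFin₄ (suc zero)             = 1₄
  fromFin₄ (suc (suc zero))       = 2₄
  fromFin₄ (suc (suc (suc zero))) = 3₄
  from-to : ∀ z → fromFin₄ (toFin₄ z) ≡ z
  from-to 0₄ = refl
  from-to 1₄ = refl
  from-to 2₄ = refl
  from-to 3₄ = refl

residue : ℕ → ℤ₄
residue zero    = 0₄
residue (suc k) = suc₄ (residue k)

suc₄⁴ : ∀ z → suc₄ (suc₄ (suc₄ (suc₄ z))) ≡ z
suc₄⁴ 0₄ = refl
suc₄⁴ 1₄ = refl
suc₄⁴ 2₄ = refl
suc₄⁴ 3₄ = refl

residue-*4 : ∀ q → residue (q * 4) ≡ 0₄
residue-*4 zero    = refl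
residue-*4 (suc q) = trans (suc₄⁴ (residue (q * 4))) (residue-*4 q)

residue-4* : ∀ q → residue (4 * q) ≡ 0₄
residue-4* q = trans (cong residue (*-comm 4 q)) (residue-*4 q)

shift₂ : ℕ → ℤ₄ → ℤ₄
shift₂ zero    z = z
shift₂ (suc k) z = suc₄ (suc₄ (shift₂ k z))

shift₂-suc₄ : ∀ k z → shift₂ k (suc₄ z) ≡ suc₄ (shift₂ k z)
shift₂-suc₄ zero    z = refl
shift₂-suc₄ (suc k) z = cong (suc₄ ∘ suc₄) (shift₂-suc₄ k z)

shift₂-suc : ∀ k z → shift₂ (suc k) z ≡ shift₂ k (suc₄ (suc₄ z))
shift₂-suc k z = sym (trans (shift₂-suc₄ k (suc₄ z)) (cong suc₄ (shift₂-suc₄ k z)))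

shift₂-injective : ∀ k {a b} → shift₂ k a ≡ shift₂ k b → a ≡ b
shift₂-injective zero    e = e
shift₂-injective (suc k) e = shift₂-injective k (suc₄-injective (suc₄-injective e))

module CycleSteps (m′ : ℕ) where

  m : ℕ
  m = suc m′

  Next : Fin m → Fin m → Set
  Next i j = T (succMod m i j)

  Next-cases : ∀ {i j} → Next i j → (toℕ j ≡ suc (toℕ i)) ⊎ (toℕ i ≡ m′ × toℕ j ≡ 0)
  Next-cases {i} {j} ij with (toℕ j ≡ᵇ suc (toℕ i)) in j≡1+i
  ... | true  = inj₁ (≡ᵇ⇒≡ _ _ (true⇒T j≡1+i))
  ... | false with (toℕ i ≡ᵇ m′) in i≡last | (toℕ j ≡ᵇ 0) in j≡0
  ...   | true | true = inj₂ (≡ᵇ⇒≡ _ _ (true⇒T i≡last) , ≡ᵇ⇒≡ _ _ (true⇒T j≡0))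

  Next-functional : ∀ {i j₁ j₂} → Next i j₁ → Next i j₂ → j₁ ≡ j₂
  Next-functional {i} {j₁} {j₂} ij₁ ij₂ with Next-cases {i} {j₁} ij₁ | Next-cases {i} {j₂} ij₂
  ... | inj₁ a       | inj₁ b       = toℕ-injective (trans a (sym b))
  ... | inj₂ (_ , a) | inj₂ (_ , b) = toℕ-injective (trans a (sym b))
  ... | inj₁ a       | inj₂ (b , _) = ⊥-elim (<-irrefl (trans a (cong suc b)) (toℕ<n j₁))
  ... | inj₂ (b , _) | inj₁ a       = ⊥-elim (<-irrefl (trans a (cong suc b)) (toℕ<n j₂))

  Next-injective : ∀ {i₁ i₂ j} → Next i₁ j → Next i₂ j → i₁ ≡ i₂
  Next-injective {i₁} {i₂} {j} i₁j i₂j with Next-cases {i₁} {j} i₁j | Next-cases {i₂} {j} i₂j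
  ... | inj₁ a       | inj₁ b       = toℕ-injective (suc-injective (trans (sym a) b))
  ... | inj₂ (a , _) | inj₂ (b , _) = toℕ-injective (trans a (sym b))
  ... | inj₁ a       | inj₂ (_ , b) with () ← trans (sym a) b
  ... | inj₂ (_ , b) | inj₁ a       with () ← trans (sym a) b

  Next⇒CycleAdj : ∀ {i j} → Next i j → CycleAdj m i j
  Next⇒CycleAdj i→j = Equivalence.from T-∨ (inj₁ i→j)

  CycleAdj-sym : ∀ {i j} → CycleAdj m i j → CycleAdj m j i
  CycleAdj-sym {i} {j} = subst T (∨-comm (succMod m i j) (succMod m j i))

  Next-last : Next (fromℕ m′) zero
  Next-last = Equivalence.from T-∧ (≡⇒≡ᵇ _ _ (toℕ-fromℕ m′) , _)

  CycleAdj-cases : ∀ {i j} → CycleAdj m i j → Next i j ⊎ Next j i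
  CycleAdj-cases {i} {j} ij with succMod m i j
  ... | true  = inj₁ _
  ... | false = inj₂ ij

  Next-irrefl : m′ ≢ 0 → ∀ {i} → ¬ Next i i
  Next-irrefl m′≢0 {i} i→i with Next-cases {i} {i} i→i
  ... | inj₁ i≡1+i        = 1+n≢n (sym i≡1+i)
  ... | inj₂ (i≡m′ , i≡0) = m′≢0 (trans (sym i≡m′) i≡0)

  CycleAdj-irrefl : m′ ≢ 0 → ∀ {i} → ¬ CycleAdj m i i
  CycleAdj-irrefl m′≢0 {i} ii with CycleAdj-cases {i} {i} ii
  ... | inj₁ i→i = Next-irrefl m′≢0 {i} i→i
  ... | inj₂ i→i = Next-irrefl m′≢0 {i} i→i

module CycleResidues (m′ : ℕ) (4∣m : residue (suc m′) ≡ 0₄) where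

  open CycleSteps m′ public

  residueᶠ : Fin m → ℤ₄
  residueᶠ i = residue (toℕ i)

  last-residue : residue m′ ≡ 3₄
  last-residue = suc₄-injective 4∣m

  Next-residue : ∀ {i j} → Next i j → residueᶠ j ≡ suc₄ (residueᶠ i)
  Next-residue {i} {j} ij with Next-cases {i} {j} ij
  ... | inj₁ j≡1+i          rewrite j≡1+i = refl
  ... | inj₂ (i≡last , j≡0) rewrite i≡last | j≡0 | last-residue = refl

  Next-asym : ∀ {i j} → Next i j → ¬ Next j i
  Next-asym {i} {j} ij ji =
    suc₄²z≢z (residueᶠ i) (trans (cong suc₄ (sym (Next-residue {i} {j} ij))) (sym (Next-residue {j} {i} ji)))

  CycleAdj-parity : ∀ {i j} → CycleAdj m i j → odd₄ (residueᶠ i) ≢ odd₄ (residueᶠ j)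
  CycleAdj-parity {i} {j} ij with CycleAdj-cases {i} {j} ij
  ... | inj₁ i→j = λ e →
        not-¬ refl (trans e (trans (cong odd₄ (Next-residue {i} {j} i→j)) (odd₄-suc₄ (residueᶠ i))))
  ... | inj₂ j→i = λ e →
        not-¬ refl (trans (sym e) (trans (cong odd₄ (Next-residue {j} {i} j→i)) (odd₄-suc₄ (residueᶠ j))))

  lowEnd : Fin m → Fin m → Fin m
  lowEnd i j = if succMod m i j then i else j

  lowEnd-cases : ∀ {i j} → CycleAdj m i j → (Next i j × lowEnd i j ≡ i) ⊎ (Next j i × lowEnd i j ≡ j)
  lowEnd-cases {i} {j} ij with succMod m i j
  ... | true  = inj₁ (_ , refl)
  ... | false = inj₂ (ij , refl)

  lowEnd-sym : ∀ {i j} → CycleAdj m i j → CycleAdj m j i → lowEnd i j ≡ lowEnd j i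
  lowEnd-sym {i} {j} ij ji with lowEnd-cases {i} {j} ij | lowEnd-cases {j} {i} ji
  ... | inj₁ (_ , a)    | inj₂ (_ , b)     = trans a (sym b)
  ... | inj₂ (_ , a)    | inj₁ (_ , b)     = trans a (sym b)
  ... | inj₁ (i→j , _)  | inj₁ (j→i , _)   = ⊥-elim (Next-asym {i} {j} i→j j→i)
  ... | inj₂ (j→i , _)  | inj₂ (i→j , _)   = ⊥-elim (Next-asym {i} {j} i→j j→i)

  lowResidue : Fin m → Fin m → ℤ₄
  lowResidue i j = residueᶠ (lowEnd i j)

  lowResidue-injective : ∀ {u v₁ v₂} → CycleAdj m u v₁ → CycleAdj m u v₂ →
                         lowResidue u v₁ ≡ lowResidue u v₂ → v₁ ≡ v₂
  lowResidue-injective {u} {v₁} {v₂} uv₁ uv₂ e with lowEnd-cases {u} {v₁} uv₁ | lowEnd-cases {u} {v₂} uv₂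
  ... | inj₁ (u→v₁ , _)  | inj₁ (u→v₂ , _)  = Next-functional {u} {v₁} {v₂} u→v₁ u→v₂
  ... | inj₂ (v₁→u , _)  | inj₂ (v₂→u , _)  = Next-injective {v₁} {v₂} {u} v₁→u v₂→u
  ... | inj₁ (_ , l₁)    | inj₂ (v₂→u , l₂) rewrite l₁ | l₂ =
        ⊥-elim (suc₄z≢z (residueᶠ v₂) (trans (sym (Next-residue {v₂} {u} v₂→u)) e))
  ... | inj₂ (v₁→u , l₁) | inj₁ (_ , l₂)    rewrite l₁ | l₂ =
        ⊥-elim (suc₄z≢z (residueᶠ v₁) (trans (sym (Next-residue {v₁} {u} v₁→u)) (sym e)))

  lowResidue≢+2 : ∀ {u v₁ v₂} → CycleAdj m u v₁ → CycleAdj m u v₂ →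
                  lowResidue u v₁ ≢ suc₄ (suc₄ (lowResidue u v₂))
  lowResidue≢+2 {u} {v₁} {v₂} uv₁ uv₂ e with lowEnd-cases {u} {v₁} uv₁ | lowEnd-cases {u} {v₂} uv₂
  ... | inj₁ (_ , l₁)    | inj₁ (_ , l₂)    rewrite l₁ | l₂ = suc₄²z≢z (residueᶠ u) (sym e)
  ... | inj₂ (v₁→u , l₁) | inj₂ (v₂→u , l₂) rewrite l₁ | l₂ | Next-injective {v₁} {v₂} {u} v₁→u v₂→u =
        suc₄²z≢z (residueᶠ v₂) (sym e)
  ... | inj₁ (_ , l₁)    | inj₂ (v₂→u , l₂) rewrite l₁ | l₂ =
        suc₄z≢z (suc₄ (residueᶠ v₂)) (trans (sym e) (Next-residue {v₂} {u} v₂→u))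
  ... | inj₂ (v₁→u , l₁) | inj₁ (_ , l₂)    rewrite l₁ | l₂ =
        suc₄³z≢z (residueᶠ v₁) (trans (cong (suc₄ ∘ suc₄) (sym (Next-residue {v₁} {u} v₁→u))) (sym e))

  private
    lowResidue-strong→ : ∀ {u₁ v₁ u₂ v₂} → CycleAdj m u₁ v₁ → CycleAdj m u₂ v₂ → Next u₁ u₂ →
                         lowResidue u₁ v₁ ≡ lowResidue u₂ v₂ → u₁ ≡ v₂ × v₁ ≡ u₂
    lowResidue-strong→ {u₁} {v₁} {u₂} {v₂} u₁v₁ u₂v₂ u₁→u₂ e
      with lowEnd-cases {u₁} {v₁} u₁v₁ | lowEnd-cases {u₂} {v₂} u₂v₂
    ... | inj₁ (u₁→v₁ , _) | inj₂ (v₂→u₂ , _) =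
          Next-injective {u₁} {v₂} {u₂} u₁→u₂ v₂→u₂ , Next-functional {u₁} {v₁} {u₂} u₁→v₁ u₁→u₂
    ... | inj₁ (_ , l₁) | inj₁ (_ , l₂) rewrite l₁ | l₂ =
          ⊥-elim (suc₄z≢z (residueᶠ u₁) (trans (sym (Next-residue {u₁} {u₂} u₁→u₂)) (sym e)))
    ... | inj₂ (v₁→u₁ , l₁) | inj₁ (_ , l₂) rewrite l₁ | l₂ =
          ⊥-elim (suc₄²z≢z (residueᶠ v₁) (trans (cong suc₄ (sym (Next-residue {v₁} {u₁} v₁→u₁)))
                                         (trans (sym (Next-residue {u₁} {u₂} u₁→u₂)) (sym e))))
    ... | inj₂ (v₁→u₁ , l₁) | inj₂ (v₂→u₂ , l₂) rewrite l₁ | l₂ | Next-injective {v₂} {u₁} {u₂} v₂→u₂ u₁→u₂ =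
          ⊥-elim (suc₄z≢z (residueᶠ v₁) (trans (sym (Next-residue {v₁} {u₁} v₁→u₁)) (sym e)))

  lowResidue-strong : ∀ {u₁ v₁ u₂ v₂} → CycleAdj m u₁ v₁ → CycleAdj m u₂ v₂ → CycleAdj m u₁ u₂ →
                      lowResidue u₁ v₁ ≡ lowResidue u₂ v₂ → u₁ ≡ v₂ × v₁ ≡ u₂
  lowResidue-strong {u₁} {v₁} {u₂} {v₂} u₁v₁ u₂v₂ u₁u₂ e with CycleAdj-cases {u₁} {u₂} u₁u₂
  ... | inj₁ u₁→u₂ = lowResidue-strong→ u₁v₁ u₂v₂ u₁→u₂ e
  ... | inj₂ u₂→u₁ with lowResidue-strong→ u₂v₂ u₁v₁ u₂→u₁ (sym e)
  ...   | u₂≡v₁ , v₂≡u₁ = sym v₂≡u₁ , sym u₂≡v₁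

-- The colouring

xor-cancelˡ : ∀ a {b c} → a xor b ≡ a xor c → b ≡ c
xor-cancelˡ false e = e
xor-cancelˡ true  e = not-injective e

xor-cancelʳ : ∀ {a b} c → a xor c ≡ b xor c → a ≡ b
xor-cancelʳ {a} {b} c e = xor-cancelˡ c (trans (xor-comm c a) (trans e (xor-comm b c)))

bit : Bool → Fin 2
bit false = zero
bit true  = suc zero

bit-injective : ∀ {a b} → bit a ≡ bit b → a ≡ b
bit-injective {false} {false} _ = refl
bit-injective {true}  {true}  _ = refl

join-injective : ∀ m n {i j : Fin m ⊎ Fin n} → join m n i ≡ join m n j → i ≡ j
join-injective m n {i} {j} e = trans (sym (splitAt-join m n i)) (trans (cong (splitAt m) e) (splitAt-join m n j))

SameEdge : {V : Set} → V → V → V → V → Set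
SameEdge u v x y = (u ≡ x × v ≡ y) ⊎ (u ≡ y × v ≡ x)

module Palette (D : ℕ) where

  treeColour : (l : ℕ) → .(l < D) → Bool → Fin (2 * D + 4)
  treeColour l l<D b = join (2 * D) 4 (inj₁ (combine (bit b) (fromℕ< l<D)))

  cycleColour : ℤ₄ → Fin (2 * D + 4)
  cycleColour z = join (2 * D) 4 (inj₂ (toFin₄ z))

  treeColour-injective : ∀ {l l′ b b′} .{p : l < D} .{p′ : l′ < D} →
                         treeColour l p b ≡ treeColour l′ p′ b′ → l ≡ l′ × b ≡ b′
  treeColour-injective {l} {l′} {b} {b′} {p} {p′} e
    with combine-injective (bit b) _ (bit b′) _ (inj₁-injective (join-injective (2 * D) 4 e))
  ... | bb′ , ll′ = fromℕ<-injective l l′ p p′ ll′ , bit-injective bb′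

  cycleColour-injective : ∀ {z z′} → cycleColour z ≡ cycleColour z′ → z ≡ z′
  cycleColour-injective = toFin₄-injective ∘ inj₂-injective ∘ join-injective (2 * D) 4

  treeColour≢cycleColour : ∀ {l b z} .{p : l < D} → treeColour l p b ≢ cycleColour z
  treeColour≢cycleColour {l} {b} {z} {p} e
    with () ← join-injective (2 * D) 4 {inj₁ (combine (bit b) (fromℕ< p))} {inj₂ (toFin₄ z)} e

module UpperBound {n} (G : Graph n) (connected : Connected G) (acyclic : Acyclic G) (r : Fin n)
                  (D : ℕ) (degree≤D : ∀ x → count (adj G x) ≤ D)
                  (m′ : ℕ) (4∣m : residue (suc m′) ≡ 0₄) where

  open EdgeLabelling G connected acyclic r D degree≤D
  open CycleResidues m′ 4∣m
  open Palette D

  V : Set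
  V = Fin n × Fin m

  Box : V → V → Set
  Box = BoxAdj G m

  chainParity : Fin n → Bool
  chainParity c = odd₄ (residue (chainLength c))

  Above⇒chainParity≢ : ∀ {c₁ c₂} → Above c₁ c₂ → chainParity c₁ ≢ chainParity c₂
  Above⇒chainParity≢ {c₁} {c₂} above e =
    not-¬ refl (trans (sym e) (trans (cong (odd₄ ∘ residue) (chainLength-Above above))
                                     (odd₄-suc₄ (residue (chainLength c₂)))))

  parity : Fin n → Fin m → Bool
  parity c u = odd₄ (residueᶠ u) xor chainParity c

  childColour : (c : Fin n) → .(c ≢ r) → Fin m → Fin (2 * D + 4)
  childColour c c≢r u = treeColour (label c) (label-<-D c≢r) (parity c u)

  colour : (x y : V) → Box x y → Fin (2 * D + 4)
  colour (a , u) (b , v) (inj₁ _)        = cycleColour (shift₂ (depth a) (lowResidue u v))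
  colour (a , u) (b , v) (inj₂ (_ , ab)) = childColour (childEnd a b) (proj₁ (childEnd-spec ab)) u

  colour-sym : ∀ x y (p : Box x y) (q : Box y x) → colour x y p ≡ colour y x q
  colour-sym (a , u) (.a , v) (inj₁ (refl , uv)) (inj₁ (refl , vu)) =
    cong (cycleColour ∘ shift₂ (depth a) ∘ residueᶠ) (lowEnd-sym {u} {v} uv vu)
  colour-sym (a , u) (b , .u) (inj₂ (refl , ab)) (inj₂ (refl , ba)) =
    childColour-cong {p = proj₁ (childEnd-spec ab)} {proj₁ (childEnd-spec ba)} (childEnd-sym ab)
    where childColour-cong : ∀ {c c′} .{p p′} → c ≡ c′ → childColour c p u ≡ childColour c′ p′ u
          childColour-cong refl = refl
  colour-sym (a , u) (.a , v) (inj₁ (refl , _))  (inj₂ (_ , aa)) = ⊥-elim (E-irrefl G aa)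
  colour-sym (a , u) (b , .u) (inj₂ (refl , aa)) (inj₁ (refl , _)) = ⊥-elim (E-irrefl G aa)

  treeEdges-strong : ∀ {a₁ b₁ u₁ a₂ b₂ u₂} → E G a₁ b₁ → E G a₂ b₂ →
                     label (childEnd a₁ b₁) ≡ label (childEnd a₂ b₂) →
                     parity (childEnd a₁ b₁) u₁ ≡ parity (childEnd a₂ b₂) u₂ →
                     (a₁ , u₁) ≡ (a₂ , u₂) ⊎ Box (a₁ , u₁) (a₂ , u₂) →
                     SameEdge (a₁ , u₁) (b₁ , u₁) (a₂ , u₂) (b₂ , u₂)
  treeEdges-strong {u₁ = u₁} ab₁ ab₂ l p (inj₁ refl) with childEnd-label-injective ab₁ ab₂ l
  ... | refl = inj₁ (refl , refl)
  treeEdges-strong {a₁} {b₁} {u₁} {u₂ = u₂} ab₁ ab₂ l p (inj₂ (inj₁ (refl , u₁u₂)))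
    with childEnd-label-injective ab₁ ab₂ l
  ... | refl = ⊥-elim (CycleAdj-parity {u₁} {u₂} u₁u₂ (xor-cancelʳ (chainParity (childEnd a₁ b₁)) p))
  treeEdges-strong {a₁} {b₁} {u₁} {a₂} {b₂} ab₁ ab₂ l p (inj₂ (inj₂ (refl , a₁a₂)))
    with childEnd a₁ b₁ ≟ childEnd a₂ b₂
  ... | yes c₁≡c₂
    with ChildOf-same (childEnd-spec ab₁) (subst (λ c → ChildOf c a₂ b₂) (sym c₁≡c₂) (childEnd-spec ab₂)) (E⇒≢ G a₁a₂)
  ...   | a₂≡b₁ , b₂≡a₁ = inj₂ (cong (_, u₁) (sym b₂≡a₁) , cong (_, u₁) (sym a₂≡b₁))
  treeEdges-strong {a₁} {b₁} {u₁} {a₂} {b₂} ab₁ ab₂ l p (inj₂ (inj₂ (refl , a₁a₂))) | no c₁≢c₂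
    with sameLabel-joined⇒Above (proj₁ spec₁) (proj₁ spec₂) c₁≢c₂ l (ChildOf-endOf spec₁) (ChildOf-endOf spec₂) a₁a₂
    where spec₁ = childEnd-spec ab₁
          spec₂ = childEnd-spec ab₂
  ... | inj₁ above = ⊥-elim (Above⇒chainParity≢ above (xor-cancelˡ (odd₄ (residueᶠ u₁)) p))
  ... | inj₂ above = ⊥-elim (Above⇒chainParity≢ above (sym (xor-cancelˡ (odd₄ (residueᶠ u₁)) p)))

  shift₂-adjacent : ∀ {a₁ a₂ z₁ z₂} → E G a₁ a₂ → shift₂ (depth a₁) z₁ ≡ shift₂ (depth a₂) z₂ →
                    z₂ ≡ suc₄ (suc₄ z₁) ⊎ z₁ ≡ suc₄ (suc₄ z₂)
  shift₂-adjacent {a₁} {a₂} {z₁} {z₂} a₁a₂ e with edge-depth a₁a₂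
  ... | inj₁ d₁ = inj₁ (sym (shift₂-injective (depth a₂) (begin
          shift₂ (depth a₂) (suc₄ (suc₄ z₁)) ≡⟨ shift₂-suc (depth a₂) z₁ ⟨
          shift₂ (suc (depth a₂)) z₁         ≡⟨ cong (λ d → shift₂ d z₁) d₁ ⟨
          shift₂ (depth a₁) z₁               ≡⟨ e ⟩
          shift₂ (depth a₂) z₂               ∎)))
  ... | inj₂ d₂ = inj₂ (shift₂-injective (depth a₁) (begin
          shift₂ (depth a₁) z₁               ≡⟨ e ⟩
          shift₂ (depth a₂) z₂               ≡⟨ cong (λ d → shift₂ d z₂) d₂ ⟩
          shift₂ (suc (depth a₁)) z₂         ≡⟨ shift₂-suc (depth a₁) z₂ ⟩
          shift₂ (depth a₁) (suc₄ (suc₄ z₂)) ∎))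

  cycleEdges-strong : ∀ {a₁ u₁ v₁ a₂ u₂ v₂} → CycleAdj m u₁ v₁ → CycleAdj m u₂ v₂ →
                      shift₂ (depth a₁) (lowResidue u₁ v₁) ≡ shift₂ (depth a₂) (lowResidue u₂ v₂) →
                      (a₁ , u₁) ≡ (a₂ , u₂) ⊎ Box (a₁ , u₁) (a₂ , u₂) →
                      SameEdge (a₁ , u₁) (a₁ , v₁) (a₂ , u₂) (a₂ , v₂)
  cycleEdges-strong {a₁} {u₁} {v₁} {v₂ = v₂} u₁v₁ u₂v₂ e (inj₁ refl)
    with lowResidue-injective {u₁} {v₁} {v₂} u₁v₁ u₂v₂ (shift₂-injective (depth a₁) e)
  ... | refl = inj₁ (refl , refl)
  cycleEdges-strong {a₁} {u₁} {v₁} {u₂ = u₂} {v₂} u₁v₁ u₂v₂ e (inj₂ (inj₁ (refl , u₁u₂)))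
    with lowResidue-strong {u₁} {v₁} {u₂} {v₂} u₁v₁ u₂v₂ u₁u₂ (shift₂-injective (depth a₁) e)
  ... | u₁≡v₂ , v₁≡u₂ = inj₂ (cong (a₁ ,_) u₁≡v₂ , cong (a₁ ,_) v₁≡u₂)
  cycleEdges-strong {a₁} {u₁} {v₁} {a₂} {v₂ = v₂} u₁v₁ u₂v₂ e (inj₂ (inj₂ (refl , a₁a₂)))
    with shift₂-adjacent a₁a₂ e
  ... | inj₁ e′ = ⊥-elim (lowResidue≢+2 {u₁} {v₂} {v₁} u₂v₂ u₁v₁ e′)
  ... | inj₂ e′ = ⊥-elim (lowResidue≢+2 {u₁} {v₁} {v₂} u₁v₁ u₂v₂ e′)

  colour-strong : ∀ x y x′ y′ (p : Box x y) (q : Box x′ y′) → colour x y p ≡ colour x′ y′ q →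
                  x ≡ x′ ⊎ Box x x′ → SameEdge x y x′ y′
  colour-strong (a₁ , u₁) (.a₁ , v₁) (a₂ , u₂) (.a₂ , v₂) (inj₁ (refl , uv₁)) (inj₁ (refl , uv₂)) e touch =
    cycleEdges-strong uv₁ uv₂ (cycleColour-injective e) touch
  colour-strong (a₁ , u₁) (b₁ , .u₁) (a₂ , u₂) (b₂ , .u₂) (inj₂ (refl , ab₁)) (inj₂ (refl , ab₂)) e touch =
    let l , p = treeColour-injective e in treeEdges-strong ab₁ ab₂ l p touch
  colour-strong (a₁ , u₁) (.a₁ , v₁) (a₂ , u₂) (b₂ , .u₂) (inj₁ (refl , _)) (inj₂ (refl , _)) e _ =
    ⊥-elim (treeColour≢cycleColour {b = parity (childEnd a₂ b₂) u₂} (sym e))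
  colour-strong (a₁ , u₁) (b₁ , .u₁) (a₂ , u₂) (.a₂ , v₂) (inj₂ (refl , _)) (inj₁ (refl , _)) e _ =
    ⊥-elim (treeColour≢cycleColour {b = parity (childEnd a₁ b₁) u₁} e)

  strongColouring : StrongEdgeColoring Box (2 * D + 4)
  strongColouring = record { col = colour ; col-sym = colour-sym ; strong = colour-strong }

-- The lower bound

module _ {V : Set} {R : V → V → Set} {k} (C : StrongEdgeColoring R k) where
  open StrongEdgeColoring C

  col-sameSource : (∀ {x} → ¬ R x x) → ∀ {u v w} (p : R u v) (q : R u w) → col u v p ≡ col u w q → v ≡ w
  col-sameSource R-irrefl p q e with strong _ _ _ _ p q e (inj₁ refl)
  ... | inj₁ (_ , v≡w)    = v≡w
  ... | inj₂ (refl , refl) = ⊥-elim (R-irrefl p)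

  col-adjacentSources : ∀ {u v x y} (p : R u v) (q : R x y) → col u v p ≡ col x y q → R u x → u ≢ x → u ≢ y → ⊥
  col-adjacentSources p q e ux u≢x u≢y with strong _ _ _ _ p q e (inj₂ ux)
  ... | inj₁ (u≡x , _) = u≢x u≡x
  ... | inj₂ (u≡y , _) = u≢y u≡y

module LowerBound {n} (G : Graph n) {a b : Fin n} (ab : E G a b) (m″ : ℕ) {k}
                  (C : StrongEdgeColoring (BoxAdj G (4 + m″)) k) where

  open StrongEdgeColoring C
  open CycleSteps (3 + m″) using (m; Next-last; Next⇒CycleAdj; CycleAdj-sym; CycleAdj-irrefl)

  V : Set
  V = Fin n × Fin m

  Box : V → V → Set
  Box = BoxAdj G m

  Box-irrefl : ∀ {x} → ¬ Box x x
  Box-irrefl {_ , u} (inj₁ (_ , uu)) = CycleAdj-irrefl (λ ()) {u} uu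
  Box-irrefl (inj₂ (_ , aa)) = E-irrefl G aa

  l₀ l₁ l₂ lₘ : Fin m
  l₀ = zero
  l₁ = suc zero
  l₂ = suc (suc zero)
  lₘ = fromℕ (3 + m″)

  l₀~l₁ : CycleAdj m l₀ l₁
  l₀~l₁ = _

  -- The edges at (a , l₀), those at (a , l₁) other than (a , l₁)(a , l₀), and (b , l₀)(b , l₁).
  data Spoke₀ : Set where
    tree₀     : Fin n → Spoke₀
    up₀ down₀ : Spoke₀

  data Spoke₁ : Set where
    tree₁ : Fin n → Spoke₁
    up₁   : Spoke₁

  data Slot : Set where
    at₀  : Spoke₀ → Slot
    at₁  : Spoke₁ → Slot
    rung : Slot

  end₀ : Spoke₀ → V
  end₀ (tree₀ y) = y , l₀
  end₀ up₀       = a , l₁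
  end₀ down₀     = a , lₘ

  end₁ : Spoke₁ → V
  end₁ (tree₁ y) = y , l₁
  end₁ up₁       = a , l₂

  present : Slot → Bool
  present (at₀ (tree₀ y)) = adj G a y
  present (at₁ (tree₁ y)) = adj G a y
  present _               = true

  spoke₀ : ∀ s → T (present (at₀ s)) → Box (a , l₀) (end₀ s)
  spoke₀ (tree₀ y) ay = inj₂ (refl , ay)
  spoke₀ up₀       _  = inj₁ (refl , l₀~l₁)
  spoke₀ down₀     _  = inj₁ (refl , CycleAdj-sym {lₘ} {l₀} (Next⇒CycleAdj {lₘ} {l₀} Next-last))

  spoke₁ : ∀ s → T (present (at₁ s)) → Box (a , l₁) (end₁ s)
  spoke₁ (tree₁ y) ay = inj₂ (refl , ay)
  spoke₁ up₁       _  = inj₁ (refl , _)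

  colourOf : ∀ s → T (present s) → Fin k
  colourOf (at₀ s) p = col _ _ (spoke₀ s p)
  colourOf (at₁ s) p = col _ _ (spoke₁ s p)
  colourOf rung    _ = col (b , l₀) (b , l₁) (inj₁ (refl , l₀~l₁))

  end₀-injective : ∀ {s t} → end₀ s ≡ end₀ t → s ≡ t
  end₀-injective {s} {t} e = trans (sym (decode-end s)) (trans (cong decode e) (decode-end t))
    where
    decode : V → Spoke₀
    decode (y , zero)        = tree₀ y
    decode (_ , suc zero)    = up₀
    decode (_ , suc (suc _)) = down₀
    decode-end : ∀ s → decode (end₀ s) ≡ s
    decode-end (tree₀ y) = refl
    decode-end up₀       = refl
    decode-end down₀     = refl

  end₁-injective : ∀ {s t} → end₁ s ≡ end₁ t → s ≡ t
  end₁-injective {tree₁ y} {tree₁ .y} refl = refl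
  end₁-injective {up₁}     {up₁}      refl = refl

  l₀∉end₁ : ∀ s → (a , l₀) ≢ end₁ s
  l₀∉end₁ (tree₁ y) ()
  l₀∉end₁ up₁       ()

  a≢b : a ≢ b
  a≢b = E⇒≢ G ab

  colourOf-injective : ∀ s t (ps : T (present s)) (pt : T (present t)) → colourOf s ps ≡ colourOf t pt → s ≡ t
  colourOf-injective (at₀ s) (at₀ t) ps pt e =
    cong at₀ (end₀-injective (col-sameSource C Box-irrefl (spoke₀ s ps) (spoke₀ t pt) e))
  colourOf-injective (at₁ s) (at₁ t) ps pt e =
    cong at₁ (end₁-injective (col-sameSource C Box-irrefl (spoke₁ s ps) (spoke₁ t pt) e))
  colourOf-injective rung    rung    _  _  _ = refl
  colourOf-injective (at₀ s) (at₁ t) ps pt e =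
    ⊥-elim (col-adjacentSources C (spoke₀ s ps) (spoke₁ t pt) e (inj₁ (refl , l₀~l₁)) (λ ()) (l₀∉end₁ t))
  colourOf-injective (at₀ s) rung    ps _  e =
    ⊥-elim (col-adjacentSources C (spoke₀ s ps) _ e (inj₂ (refl , ab)) (a≢b ∘ cong proj₁) (λ ()))
  colourOf-injective (at₁ s) rung    ps _  e =
    ⊥-elim (col-adjacentSources C (spoke₁ s ps) (inj₁ (refl , CycleAdj-sym {l₀} {l₁} l₀~l₁))
             (trans e (col-sym _ _ _ _)) (inj₂ (refl , ab)) (a≢b ∘ cong proj₁) (λ ()))
  colourOf-injective (at₁ s) (at₀ t) ps pt e = sym (colourOf-injective (at₀ t) (at₁ s) pt ps (sym e))
  colourOf-injective rung    (at₀ t) ps pt e = sym (colourOf-injective (at₀ t) rung pt ps (sym e))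
  colourOf-injective rung    (at₁ t) ps pt e = sym (colourOf-injective (at₁ t) rung pt ps (sym e))

  extra₀ : Fin 2 → Spoke₀
  extra₀ zero       = up₀
  extra₀ (suc zero) = down₀

  spokeOf₀ : Fin (n + 2) → Spoke₀
  spokeOf₀ = [ tree₀ , extra₀ ]′ ∘ splitAt n

  spokeOf₁ : Fin (n + 1) → Spoke₁
  spokeOf₁ = [ tree₁ , const up₁ ]′ ∘ splitAt n

  slot₁ : Fin ((n + 1) + 1) → Slot
  slot₁ = [ at₁ ∘ spokeOf₁ , const rung ]′ ∘ splitAt (n + 1)

  slot : Fin ((n + 2) + ((n + 1) + 1)) → Slot
  slot = [ at₀ ∘ spokeOf₀ , slot₁ ]′ ∘ splitAt (n + 2)

  slot-injective : Injective _≡_ _≡_ slot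
  slot-injective = [,]∘splitAt-injective (n + 2) ((n + 1) + 1)
    (spokeOf₀-injective ∘ at₀-injective)
    ([,]∘splitAt-injective (n + 1) 1 (spokeOf₁-injective ∘ at₁-injective) (Fin1-injective _) (λ _ _ ()))
    at₀≢slot₁
    where
    at₀≢slot₁ : ∀ i j → at₀ (spokeOf₀ i) ≢ slot₁ j
    at₀≢slot₁ i j with splitAt (n + 1) j
    ... | inj₁ _ = λ ()
    ... | inj₂ _ = λ ()
    Fin1-injective : ∀ {A : Set} (f : Fin 1 → A) → Injective _≡_ _≡_ f
    Fin1-injective f {zero} {zero} _ = refl
    at₀-injective : ∀ {s t} → at₀ s ≡ at₀ t → s ≡ t
    at₀-injective refl = refl
    at₁-injective : ∀ {s t} → at₁ s ≡ at₁ t → s ≡ t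
    at₁-injective refl = refl
    tree₀-injective : ∀ {y z} → tree₀ y ≡ tree₀ z → y ≡ z
    tree₀-injective refl = refl
    tree₁-injective : ∀ {y z} → tree₁ y ≡ tree₁ z → y ≡ z
    tree₁-injective refl = refl
    extra₀-injective : Injective _≡_ _≡_ extra₀
    extra₀-injective {zero}     {zero}     _ = refl
    extra₀-injective {suc zero} {suc zero} _ = refl
    extra₀-injective {zero}     {suc zero} ()
    extra₀-injective {suc zero} {zero}     ()
    tree₀≢extra₀ : ∀ y i → tree₀ y ≢ extra₀ i
    tree₀≢extra₀ y zero       ()
    tree₀≢extra₀ y (suc zero) ()
    spokeOf₀-injective : Injective _≡_ _≡_ spokeOf₀
    spokeOf₀-injective = [,]∘splitAt-injective n 2 tree₀-injective extra₀-injective tree₀≢extra₀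
    spokeOf₁-injective : Injective _≡_ _≡_ spokeOf₁
    spokeOf₁-injective = [,]∘splitAt-injective n 1 tree₁-injective (Fin1-injective _) (λ _ _ ())

  count-present : count (present ∘ slot) ≡ 2 * count (adj G a) + 4
  count-present = begin
    count (present ∘ slot)                                      ≡⟨ count-splitAt (n + 2) _ (present ∘ [ at₀ ∘ spokeOf₀ , slot₁ ]′) ⟩
    count (present ∘ at₀ ∘ spokeOf₀) + count (present ∘ slot₁) ≡⟨ cong₂ _+_ spokes₀ spokes₁ ⟩
    (d + 2) + ((d + 1) + 1)                                     ≡⟨ solve 1 (λ d → (d :+ con 2) :+ ((d :+ con 1) :+ con 1) := con 2 :* d :+ con 4) refl d ⟩
    2 * d + 4                                                   ∎
    where
    d = count (adj G a)
    spokes₀ : count (present ∘ at₀ ∘ spokeOf₀) ≡ d + 2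
    spokes₀ = count-splitAt n 2 (present ∘ at₀ ∘ [ tree₀ , extra₀ ]′)
    spokes₁ : count (present ∘ slot₁) ≡ (d + 1) + 1
    spokes₁ = trans (count-splitAt (n + 1) 1 (present ∘ [ at₁ ∘ spokeOf₁ , const rung ]′))
                    (cong (_+ 1) (count-splitAt n 1 (present ∘ at₁ ∘ [ tree₁ , const up₁ ]′)))

  lowerBound : 2 * count (adj G a) + 4 ≤ k
  lowerBound = subst (_≤ k) count-present
    (count-≤-injective (present ∘ slot) (λ i → colourOf (slot i)) (λ pi pj → slot-injective ∘ colourOf-injective _ _ pi pj))

Δ-pos : ∀ {n} (G : Graph n) {u v} → E G u v → 0 < Δ G
Δ-pos G {u} {v} uv = ≤-trans (count-pos (adj G u) v uv) (degree≤Δ G u)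

maxDegree-vertex : ∀ {n} (G : Graph n) {u v} → E G u v → ∃ λ a → count (adj G a) ≡ Δ G × ∃ (E G a)
maxDegree-vertex G uv with foldr-⊔-attained (degree G) id
... | inj₁ Δ≡0         = ⊥-elim (<⇒≢ (Δ-pos G uv) (sym Δ≡0))
... | inj₂ (a , deg≡Δ) = a , count≡Δ , count-witness (adj G a) (subst (0 <_) (sym count≡Δ) (Δ-pos G uv))
  where count≡Δ = trans (sym (degree≡count G a)) deg≡Δ

tree□C₄ₗ-strongColouring : ∀ {n} (T : Graph n) → IsTree T → Fin n → ∀ ℓ → 1 ≤ ℓ →
                           StrongEdgeColoring (BoxAdj T (4 * ℓ)) (2 * Δ T + 4)
tree□C₄ₗ-strongColouring T (connected , acyclic) r (suc l) _ =
  UpperBound.strongColouring T connected acyclic r (Δ T) (degree≤Δ T) (pred (4 * suc l)) (residue-4* (suc l))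

□C-strongColouring-≥ : ∀ {n} (G : Graph n) {a b} → E G a b → ∀ m → 4 ≤ m → ∀ {k} →
                       StrongEdgeColoring (BoxAdj G m) k → 2 * count (adj G a) + 4 ≤ k
□C-strongColouring-≥ G ab m 4≤m C with m≤n⇒∃[o]m+o≡n 4≤m
... | m″ , refl = LowerBound.lowerBound G ab m″ C

theorem9 : (n : ℕ) (T : Graph n) → IsTree T → (∃[ u ] ∃[ v ] E T u v) →
           (ℓ : ℕ) → 1 ≤ ℓ →
           StrongChromaticIndexIs (BoxAdj T (4 * ℓ)) (2 * Δ T + 4)
theorem9 n T tree (u , v , uv) ℓ 1≤ℓ with maxDegree-vertex T uv
... | a , deg≡Δ , b , ab =
  tree□C₄ₗ-strongColouring T tree u ℓ 1≤ℓ ,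
  λ k C → subst (λ d → 2 * d + 4 ≤ k) deg≡Δ (□C-strongColouring-≥ T ab (4 * ℓ) (*-monoʳ-≤ 4 1≤ℓ) C)
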